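{- The modal $\mu$-calculus under finitely bounded semantics (i.e., $\Gamma$-bounded semantics with $\Gamma=\omega$) does not have the finite model property: there exists a sentence $\varphi$ of the modal $\mu$-calculus (closed under negation via negation normal form) such that $\mathcal{M},w\Vdash^\omega\varphi$ for some Kripke model $\mathcal{M}$ and state $w$, but there is no finite Kripke model $\mathcal{M}'$ and state $w'$ with $\mathcal{M}',w'\Vdash^\omega\varphi$.
   Context: Formulae of the modal $\mu$-calculus over proposition symbols $\Phi$ and label symbols $\Lambda$: $\varphi ::= p \mid \neg p \mid X \mid \varphi\vee\varphi \mid \varphi\wedge\varphi \mid \Diamond\varphi \mid \Box\varphi \mid \mu X\varphi \mid \nu X\varphi$; a sentence has no free labels. $\mathrm{Sub}(\varphi_0)$: nodes of the syntax tree (occurrences distinguished); $\mathrm{Sub}_{\mu\nu}(\varphi_0)$: those of form $\mu X\psi$ or $\nu X\psi$; $\mathrm{rf}(X)$: for an occurrence of label $X$, the nearest ancestor of form $\mu X\psi$ or $\nu X\psi$. Kripke model $\mathcal{M}=(W,R,V)$. $\omega$-bounded evaluation game $(\mathcal{M},w_0,\varphi_0,\omega)$: positions $(w,\varphi,c)$ with $c:\mathrm{Sub}_{\mu\nu}(\varphi_0)\to\{\gamma\mid\gamma\le\omega\}$, initial $(w_0,\varphi_0,c_0)$ with $c_0\equiv\omega$. At $(w,p,c)$ Eloise wins iff $w\in V(p)$, else Abelard; at $(w,\neg p,c)$ Eloise wins iff $w\notin V(p)$, else Abelard; at $\vee$ Eloise, at $\wedge$ Abelard picks the next subformula; at $\Diamond\psi$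 Eloise, at $\Box\psi$ Abelard, picks an $R$-successor $v$ (play goes to $(v,\psi,c)$), losing if none exists; at $(w,\mu X\psi,c)$ Eloise (at $\nu X\psi$ Abelard) chooses a natural number $n$ and play goes to $(w,\psi,c[n/\text{that formula}])$. At $(w,X,c)$ with $\gamma=c(\mathrm{rf}(X))$: if $\mathrm{rf}(X)=\mu X\psi$, Abelard wins if $\gamma=0$, otherwise Eloise chooses $\gamma'<\gamma$ and play goes to $(w,\psi,c')$ where $c'(\mu X\psi)=\gamma'$, $c'(\theta)=\omega$ for all $\theta\in\mathrm{Sub}_{\mu\nu}(\varphi_0)$ inside $\psi$, and $c'=c$ elsewhere; if $\mathrm{rf}(X)=\nu X\psi$, the same with players swapped. $\mathcal{M},w_0\Vdash^\omega\varphi_0$ iff Eloise has a winning strategy. Negations of sentences are understood via the standard translation into this negation normal form syntax (dualising $\vee/\wedge$, $\Diamond/\Box$, $\mu/\nu$, literals). -}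

module Defs where

open import Data.Nat using (ℕ; zero; suc)
open import Data.Bool using (Bool; true; false; if_then_else_; _∧_)
open import Data.List using (List; []; _∷_; _∷ʳ_)
open import Data.List.Membership.Propositional using (_∈_)
open import Data.Maybe using (Maybe; just; nothing)
open import Data.Product using (Σ; Σ-syntax; _×_; _,_)
open import Data.Fin using (Fin)
open import Function.Bundles using (_↔_)
open import Relation.Nullary using (¬_; yes; no)
open import Relation.Binary.PropositionalEquality using (_≡_)
import Data.Nat as ℕ

data Fix : Set where
  μF νF : Fix

data Formula : Set where
  prop  : ℕ → Formula
  nprop : ℕ → Formula
  var   : ℕ → Formula
  _∨′_  : Formula → Formula → Formula
  _∧′_  : Formula → Formula → Formula
  ◇     : Formula → Formula
  □     : Formula → Formula
  fp    : Fix → ℕ → Formula → Formula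

data ClosedIn (Γ : List ℕ) : Formula → Set where
  prop  : ∀ p → ClosedIn Γ (prop p)
  nprop : ∀ p → ClosedIn Γ (nprop p)
  var   : ∀ {X} → X ∈ Γ → ClosedIn Γ (var X)
  or    : ∀ {φ ψ} → ClosedIn Γ φ → ClosedIn Γ ψ → ClosedIn Γ (φ ∨′ ψ)
  and   : ∀ {φ ψ} → ClosedIn Γ φ → ClosedIn Γ ψ → ClosedIn Γ (φ ∧′ ψ)
  dia   : ∀ {φ} → ClosedIn Γ φ → ClosedIn Γ (◇ φ)
  box   : ∀ {φ} → ClosedIn Γ φ → ClosedIn Γ (□ φ)
  bind  : ∀ {b X φ} → ClosedIn (X ∷ Γ) φ → ClosedIn Γ (fp b X φ)

Sentence : Formula → Set
Sentence φ = ClosedIn [] φ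

-- Occurrences of subformulas (nodes of the syntax tree of φ₀),
-- given as the path from the root.  Occ φ₀ ψ : an occurrence of ψ in φ₀.

data Occ (φ₀ : Formula) : Formula → Set where
  root : Occ φ₀ φ₀
  ∨l   : ∀ {φ ψ} → Occ φ₀ (φ ∨′ ψ) → Occ φ₀ φ
  ∨r   : ∀ {φ ψ} → Occ φ₀ (φ ∨′ ψ) → Occ φ₀ ψ
  ∧l   : ∀ {φ ψ} → Occ φ₀ (φ ∧′ ψ) → Occ φ₀ φ
  ∧r   : ∀ {φ ψ} → Occ φ₀ (φ ∧′ ψ) → Occ φ₀ ψ
  ◇↓   : ∀ {φ} → Occ φ₀ (◇ φ) → Occ φ₀ φ
  □↓   : ∀ {φ} → Occ φ₀ (□ φ) → Occ φ₀ φ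
  fp↓  : ∀ {b X φ} → Occ φ₀ (fp b X φ) → Occ φ₀ φ

-- Directions, used to compare occurrences (an occurrence is determined
-- by its root-to-node path).
data Dir : Set where
  L R D : Dir

eqDir : Dir → Dir → Bool
eqDir L L = true
eqDir R R = true
eqDir D D = true
eqDir _ _ = false

path : ∀ {φ₀ ψ} → Occ φ₀ ψ → List Dir
path root    = []
path (∨l o)  = path o ∷ʳ L
path (∨r o)  = path o ∷ʳ R
path (∧l o)  = path o ∷ʳ L
path (∧r o)  = path o ∷ʳ R
path (◇↓ o)  = path o ∷ʳ D
path (□↓ o)  = path o ∷ʳ D
path (fp↓ o) = path o ∷ʳ D

eqPath : List Dir → List Dir → Bool
eqPath []       []       = true
eqPath (x ∷ xs) (y ∷ ys) = eqDir x y ∧ eqPath xs ys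
eqPath _        _        = false

strictPrefix : List Dir → List Dir → Bool
strictPrefix []       []       = false
strictPrefix []       (_ ∷ _)  = true
strictPrefix (_ ∷ _)  []       = false
strictPrefix (x ∷ xs) (y ∷ ys) = eqDir x y ∧ strictPrefix xs ys

FpOcc : Formula → Set
FpOcc φ₀ = Σ[ b ∈ Fix ] Σ[ X ∈ ℕ ] Σ[ θ ∈ Formula ] Occ φ₀ (fp b X θ)

rf : ∀ {φ₀ ψ} → ℕ → Occ φ₀ ψ → Maybe (FpOcc φ₀)
rf X root    = nothing
rf X (∨l o)  = rf X o
rf X (∨r o)  = rf X o
rf X (∧l o)  = rf X o
rf X (∧r o)  = rf X o
rf X (◇↓ o)  = rf X o
rf X (□↓ o)  = rf X o
rf X (fp↓ {b} {Y} {θ} o) with Y ℕ.≟ X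
... | yes _ = just (b , Y , θ , o)
... | no  _ = rf X o

data Ord : Set where
  fin : ℕ → Ord
  ω   : Ord

data _<ᴼ_ : Ord → Ord → Set where
  fin<fin : ∀ {m n} → m ℕ.< n → fin m <ᴼ fin n
  fin<ω   : ∀ {m} → fin m <ᴼ ω

Counter : Formula → Set
Counter φ₀ = FpOcc φ₀ → Ord

occPath : ∀ {φ₀} → FpOcc φ₀ → List Dir
occPath (_ , _ , _ , o) = path o

upd : ∀ {φ₀} → Counter φ₀ → FpOcc φ₀ → Ord → Counter φ₀
upd c o γ o' = if eqPath (occPath o') (occPath o) then γ else c o'

regen : ∀ {φ₀} → Counter φ₀ → FpOcc φ₀ → Ord → Counter φ₀
regen c o γ o' =
  if eqPath (occPath o') (occPath o) then γ
  else (if strictPrefix (occPath o) (occPath o') then ω else c o')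

record Model : Set₁ where
  field
    W : Set
    Rel : W → W → Set
    V : ℕ → W → Set

Finite : Model → Set
Finite M = Σ[ n ∈ ℕ ] (Model.W M ↔ Fin n)

-- EWin M φ₀ w o c : Eloise wins the game
-- from position (w, ψ, c), where o is the occurrence of ψ in φ₀.
-- (All plays are finite, so this inductive definition is exactly the
-- existence of a winning strategy for Eloise.)

module _ (M : Model) (φ₀ : Formula) where
  open Model M

  data EWin (w : W) : ∀ {ψ} → Occ φ₀ ψ → Counter φ₀ → Set where
    prop  : ∀ {p} {o : Occ φ₀ (prop p)} {c} → V p w → EWin w o c
    nprop : ∀ {p} {o : Occ φ₀ (nprop p)} {c} → ¬ V p w → EWin w o c
    orL   : ∀ {φ ψ} {o : Occ φ₀ (φ ∨′ ψ)} {c} → EWin w (∨l o) c → EWin w o c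
    orR   : ∀ {φ ψ} {o : Occ φ₀ (φ ∨′ ψ)} {c} → EWin w (∨r o) c → EWin w o c
    and   : ∀ {φ ψ} {o : Occ φ₀ (φ ∧′ ψ)} {c} →
            EWin w (∧l o) c → EWin w (∧r o) c → EWin w o c
    dia   : ∀ {φ} {o : Occ φ₀ (◇ φ)} {c} (v : W) →
            Rel w v → EWin v (◇↓ o) c → EWin w o c
    box   : ∀ {φ} {o : Occ φ₀ (□ φ)} {c} →
            ((v : W) → Rel w v → EWin v (□↓ o) c) → EWin w o c
    mu    : ∀ {X φ} {o : Occ φ₀ (fp μF X φ)} {c} (n : ℕ) →
            EWin w (fp↓ o) (upd c (μF , X , φ , o) (fin n)) → EWin w o c
    nu    : ∀ {X φ} {o : Occ φ₀ (fp νF X φ)} {c} →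
            ((n : ℕ) → EWin w (fp↓ o) (upd c (νF , X , φ , o) (fin n))) → EWin w o c
    varμ  : ∀ {X} {o : Occ φ₀ (var X)} {c} {Y θ} {o' : Occ φ₀ (fp μF Y θ)} →
            rf X o ≡ just (μF , Y , θ , o') →
            (γ' : ℕ) → fin γ' <ᴼ c (μF , Y , θ , o') →
            EWin w (fp↓ o') (regen c (μF , Y , θ , o') (fin γ')) → EWin w o c
    varν  : ∀ {X} {o : Occ φ₀ (var X)} {c} {Y θ} {o' : Occ φ₀ (fp νF Y θ)} →
            rf X o ≡ just (νF , Y , θ , o') →
            ((γ' : ℕ) → fin γ' <ᴼ c (νF , Y , θ , o') →
              EWin w (fp↓ o') (regen c (νF , Y , θ , o') (fin γ'))) → EWin w o c

c₀ : ∀ {φ₀} → Counter φ₀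
c₀ _ = ω

_,_⊩ω_ : (M : Model) → Model.W M → Formula → Set
M , w ⊩ω φ₀ = EWin M φ₀ w root c₀

module Submission where

open import Defs
open import Data.Product using (Σ; Σ-syntax; _×_; _,_; proj₁; proj₂)
open import Relation.Nullary using (¬_)
open import Data.Nat using (ℕ; zero; suc; _+_; _≤_; _<_; z≤n; s≤s; s≤s⁻¹)
open import Data.Nat.Properties
  using (≤-refl; ≤-trans; <-≤-trans; <-irrefl; m≤m+n; m≤n+m; m≤n⇒m≤1+n; m≤n⇒m<n∨m≡n; n≮0)
open import Data.Maybe using (Maybe; just; nothing)
open import Data.List.Relation.Unary.Any using (here)
open import Data.Sum using (inj₁; inj₂)
open import Data.Empty using (⊥; ⊥-elim)
open import Data.Fin using (Fin; toℕ)
open import Data.Fin.Properties using (pigeonhole)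
open import Function using (_∘_)
open import Function.Bundles using (_↔_; Inverse; Injection)
open import Function.Properties.Inverse using (↔⇒↣)
open import Relation.Binary.PropositionalEquality using (_≡_; _≢_; refl; sym; subst)

-- Under ω-bounded semantics νX◇X holds at w iff for every n there is a walk of
-- length n from w, and μY□Y holds at w iff the lengths of walks from w are
-- bounded.  So φ = νX◇X ∧ □μY□Y asks for successors carrying arbitrarily long
-- walks, each of which bounds the walks from itself.  The fan (a root with a
-- descending chain of every length below it) satisfies φ.  In a finite model
-- the successors cannot all be distinct along the sequence of lengths
-- s₀ = 0, sₖ₊₁ = sₖ + 1 + (bound of the successor chosen for sₖ), and a repeated
-- successor would carry a walk longer than its own bound.

leap : (ℕ → ℕ) → ℕ → ℕ
leap b zero    = 0
leap b (suc k) = suc (leap b k + b (leap b k))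

leap-mono : ∀ b {i j} → i ≤ j → leap b i ≤ leap b j
leap-mono b {j = zero}  z≤n = ≤-refl
leap-mono b {j = suc j} i≤1+j with m≤n⇒m<n∨m≡n i≤1+j
... | inj₁ i<1+j = ≤-trans (leap-mono b (s≤s⁻¹ i<1+j)) (m≤n⇒m≤1+n (m≤m+n _ _))
... | inj₂ refl  = ≤-refl

bound<leap-suc : ∀ b k → b (leap b k) < leap b (suc k)
bound<leap-suc b k = s≤s (m≤n+m _ _)

bounded-cover⇒¬finite : ∀ {W : Set} (P : W → ℕ → Set) →
  (∀ n → Σ[ w ∈ W ] P w n) →
  (∀ w n → P w n → Σ[ m ∈ ℕ ] (∀ {L} → P w L → L ≤ m)) →
  ∀ {N} → ¬ (W ↔ Fin N)
bounded-cover⇒¬finite {W} P cover bounded {N} W↔Fin =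
  let i , j , i<j , same = pigeonhole ≤-refl (Inverse.to W↔Fin ∘ pick ∘ s ∘ toℕ {suc N})
  in  no-repeat i<j (Injection.injective (↔⇒↣ W↔Fin) same)
  where
    pick : ℕ → W
    pick n = proj₁ (cover n)

    bound : ℕ → ℕ
    bound n = proj₁ (bounded (pick n) n (proj₂ (cover n)))

    s : ℕ → ℕ
    s = leap bound

    no-repeat : ∀ {i j} → i < j → pick (s i) ≢ pick (s j)
    no-repeat {i} {j} i<j same = <-irrefl refl
      (<-≤-trans (bound<leap-suc bound i) (≤-trans (leap-mono bound i<j) sⱼ≤bound))
      where
        sⱼ≤bound : s j ≤ bound (s i)
        sⱼ≤bound = proj₂ (bounded (pick (s i)) (s i) (proj₂ (cover (s i))))
          (subst (λ w → P w (s j)) (sym same) (proj₂ (cover (s j))))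

data Walk (M : Model) : Model.W M → ℕ → Set where
  []  : ∀ {w} → Walk M w 0
  _∷_ : ∀ {w v n} → Model.Rel M w v → Walk M v n → Walk M w (suc n)

longWalks : Formula
longWalks = fp νF 0 (◇ (var 0))

boundedDepth : Formula
boundedDepth = fp μF 1 (□ (var 1))

φ : Formula
φ = longWalks ∧′ □ boundedDepth

φ-sentence : Sentence φ
φ-sentence = and (bind (dia (var (here refl)))) (box (bind (box (var (here refl)))))

ν-occ : FpOcc φ
ν-occ = νF , 0 , ◇ (var 0) , ∧l root

μ-occ : FpOcc φ
μ-occ = μF , 1 , □ (var 1) , □↓ (∧r root)

X-occ : Occ φ (var 0)
X-occ = ◇↓ (fp↓ (∧l root))

□Y-occ : Occ φ (□ (var 1))
□Y-occ = fp↓ (□↓ (∧r root))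

<fin⇒< : ∀ {m n γ} → γ ≡ fin n → fin m <ᴼ γ → m < n
<fin⇒< refl (fin<fin m<n) = m<n

<⇒<fin : ∀ {m n γ} → γ ≡ fin n → m < n → fin m <ᴼ γ
<⇒<fin refl m<n = fin<fin m<n

module _ {M : Model} where
  open Model M

  X-win⇒walk : ∀ {v} n (c : Counter φ) → c ν-occ ≡ fin n → EWin M φ v X-occ c → Walk M v n
  X-win⇒walk zero    c cₙ win = []
  X-win⇒walk (suc n) c cₙ (varν refl abelard)
    with dia _ v→u win ← abelard n (<⇒<fin cₙ ≤-refl)
    = v→u ∷ X-win⇒walk n _ refl win

  □Y-win⇒depth≤ : ∀ {v L} m (c : Counter φ) → c μ-occ ≡ fin m → EWin M φ v □Y-occ c →
                  Walk M v L → L ≤ m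
  □Y-win⇒depth≤ m c cₘ win [] = z≤n
  □Y-win⇒depth≤ m c cₘ (box win) (v→u ∷ walk)
    with varμ refl m' m'<m win′ ← win _ v→u
    = ≤-trans (s≤s (□Y-win⇒depth≤ m' _ refl win′ walk)) (<fin⇒< cₘ m'<m)

  ⊩φ⇒¬finite : ∀ {w} → M , w ⊩ω φ → ¬ Finite M
  ⊩φ⇒¬finite {w} (and (nu long) (box bounded)) (_ , W↔Fin) =
    bounded-cover⇒¬finite (λ v n → Rel w v × Walk M v n) long-successor bounded-successor W↔Fin
    where
      long-successor : ∀ n → Σ[ v ∈ W ] (Rel w v × Walk M v n)
      long-successor n with dia v w→v win ← long n = v , w→v , X-win⇒walk n _ refl win

      bounded-successor : ∀ v n → Rel w v × Walk M v n →
                          Σ[ m ∈ ℕ ] (∀ {L} → Rel w v × Walk M v L → L ≤ m)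
      bounded-successor v _ (w→v , _) with mu m win ← bounded v w→v =
        m , λ (_ , walk) → □Y-win⇒depth≤ m _ refl win walk

data Fan : Maybe ℕ → Maybe ℕ → Set where
  branch  : ∀ {k} → Fan nothing (just k)
  descend : ∀ {k} → Fan (just (suc k)) (just k)

fan : Model
fan = record { W = Maybe ℕ ; Rel = Fan ; V = λ _ _ → ⊥ }

fan-X-win : ∀ m k (c : Counter φ) → c ν-occ ≡ fin m → m ≤ k → EWin fan φ (just k) X-occ c
fan-X-win m zero    c cₘ z≤n   = varν refl λ m' m'<c → ⊥-elim (n≮0 (<fin⇒< cₘ m'<c))
fan-X-win m (suc k) c cₘ m≤1+k = varν refl λ m' m'<c →
  dia (just k) descend (fan-X-win m' k _ refl (s≤s⁻¹ (<-≤-trans (<fin⇒< cₘ m'<c) m≤1+k)))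

fan-□Y-win : ∀ k (c : Counter φ) → c μ-occ ≡ fin k → EWin fan φ (just k) □Y-occ c
fan-□Y-win k c cₖ =
  box λ { (just k') descend → varμ refl k' (<⇒<fin cₖ ≤-refl) (fan-□Y-win k' _ refl) }

fan⊩φ : fan , nothing ⊩ω φ
fan⊩φ = and (nu λ n → dia (just n) branch (fan-X-win n n _ refl ≤-refl))
            (box λ { (just k) branch → mu k (fan-□Y-win k _ refl) })

proposition14 : Σ[ φ ∈ Formula ] (Sentence φ
    × (Σ[ M ∈ Model ] Σ[ w ∈ Model.W M ] (M , w ⊩ω φ))
    × ¬ (Σ[ M ∈ Model ] (Finite M × (Σ[ w ∈ Model.W M ] (M , w ⊩ω φ)))))
proposition14 =
  φ , φ-sentence , (fan , nothing , fan⊩φ) , λ (_ , finite , _ , win) → ⊩φ⇒¬finite win finite
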